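{- Let $I=\{i_1,\ldots,i_k\}\subseteq[n-1]$ with $i_1<\cdots<i_k$ be a set of pairwise nonconsecutive integers, and let $\pi\in\mathfrak{S}_n$ (viewed as the tuple of its one-line notation). Then $\delta_I(\pi):=\delta_{i_1}\circ\delta_{i_2}\circ\cdots\circ\delta_{i_k}(\pi)$ belongs to $\mathrm{UFR}_n$ (with $\delta_\emptyset$ the identity).
   Context: $[n]=\{1,\ldots,n\}$. Parking process: $\alpha=(a_1,\ldots,a_n)\in[n]^n$ encodes preferences of cars $1,\ldots,n$ arriving in order at a one-way street with spots $1,\ldots,n$; car $i$ parks in spot $a_i$ if free, otherwise in the first free spot after $a_i$, if any. $\alpha$ is a parking function if all cars park. A unit interval parking function is a parking function in which each car $i$ parks in spot $a_i$ or $a_i+1$. A Fubini ranking is a tuple $(r_1,\ldots,r_n)\in[n]^n$ with $r_i=1+|\{j:r_j<r_i\}|$ for all $i$. $\mathrm{UFR}_n$ is the set of tuples that are both Fubini rankings and unit interval parking functions. For $i\in[n-1]$, $\delta_i(\alpha)=\alpha$ if some value among $i-1,i,i+1$ occurs exactly twice in $\alpha$, and otherwise $\delta_i(\alpha)$ is obtained from $\alpha$ by decreasing the single occurrence of $i+1$ to $i$. -}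

module Defs where

open import Data.Nat using (ℕ; zero; suc; _+_; _∸_; _≤_; _<_; _≡ᵇ_; _<ᵇ_)
open import Data.Bool using (Bool; true; false; if_then_else_; _∨_)
open import Data.List using (List; []; _∷_; foldr; length)
open import Data.List.Relation.Unary.All using (All)
open import Data.List.Relation.Unary.Linked using (Linked)
open import Data.Maybe using (Maybe; just; nothing)
open import Data.Vec using (Vec; toList; map; lookup)
open import Data.Fin using (Fin; toℕ)
open import Data.Fin.Permutation using (Permutation′; _⟨$⟩ʳ_)
open import Data.Product using (_×_; ∃)
open import Data.Sum using (_⊎_)
open import Relation.Binary.PropositionalEquality using (_≡_)

-- Tuples in [n]^n are represented as Vec ℕ n (entries are 1-based naturals).

countL : ℕ → List ℕ → ℕ
countL x [] = 0
countL x (y ∷ ys) = if x ≡ᵇ y then suc (countL x ys) else countL x ys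

count : ∀ {n} → ℕ → Vec ℕ n → ℕ
count x v = countL x (toList v)

countLess : ℕ → List ℕ → ℕ
countLess x [] = 0
countLess x (y ∷ ys) = if y <ᵇ x then suc (countLess x ys) else countLess x ys

memb : ℕ → List ℕ → Bool
memb x [] = false
memb x (y ∷ ys) = (x ≡ᵇ y) ∨ memb x ys

firstFree : List ℕ → ℕ → ℕ → Maybe ℕ
firstFree occ zero s = nothing
firstFree occ (suc k) s = if memb s occ then firstFree occ k (suc s) else just s

findSpot : ℕ → List ℕ → ℕ → Maybe ℕ
findSpot n occ a = firstFree occ (suc n ∸ a) a

park : ℕ → List ℕ → List ℕ → Maybe (List ℕ)
park n occ [] = just []
park n occ (a ∷ as) with findSpot n occ a
... | nothing = nothing
... | just s with park n (s ∷ occ) as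
...   | nothing = nothing
...   | just ss = just (s ∷ ss)

InRange : ∀ {n} → Vec ℕ n → Set
InRange {n} α = All (λ a → 1 ≤ a × a ≤ n) (toList α)

IsParkingFunction : ∀ {n} → Vec ℕ n → Set
IsParkingFunction {n} α = InRange α × ∃ λ ss → park n [] (toList α) ≡ just ss

data UnitSpots : List ℕ → List ℕ → Set where
  []  : UnitSpots [] []
  _∷_ : ∀ {a s as ss} → (s ≡ a ⊎ s ≡ suc a) → UnitSpots as ss → UnitSpots (a ∷ as) (s ∷ ss)

IsUnitIntervalPF : ∀ {n} → Vec ℕ n → Set
IsUnitIntervalPF {n} α =
  InRange α × ∃ λ ss → park n [] (toList α) ≡ just ss × UnitSpots (toList α) ss

IsFubiniRanking : ∀ {n} → Vec ℕ n → Set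
IsFubiniRanking {n} r =
  InRange r × (∀ (i : Fin n) → lookup r i ≡ suc (countLess (lookup r i) (toList r)))

UFR : ∀ {n} → Vec ℕ n → Set
UFR α = IsFubiniRanking α × IsUnitIntervalPF α

someTwice : ∀ {n} → ℕ → Vec ℕ n → Bool
someTwice i α = (count (i ∸ 1) α ≡ᵇ 2) ∨ (count i α ≡ᵇ 2) ∨ (count (suc i) α ≡ᵇ 2)

δ : ∀ {n} → ℕ → Vec ℕ n → Vec ℕ n
δ i α = if someTwice i α then α
        else map (λ a → if a ≡ᵇ suc i then i else a) α

δ* : ∀ {n} → List ℕ → Vec ℕ n → Vec ℕ n
δ* I α = foldr δ α I

oneLine : ∀ {n} → Permutation′ n → Vec ℕ n
oneLine π = Data.Vec.tabulate (λ i → suc (toℕ (π ⟨$⟩ʳ i)))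

NonconsecSubset : ℕ → List ℕ → Set
NonconsecSubset n I =
  All (λ i → 1 ≤ i × i ≤ n ∸ 1) I × Linked (λ a b → suc (suc a) ≤ b) I

{-# OPTIONS --safe #-}

-- Consecutive elements of I are at least two apart, so no δ_i of δ_I meets a repeated value
-- among i − 1, i, i + 1, and δ_I(π) is π with every entry c + 1 (c ∈ I) lowered to c. The
-- result uses each c ∈ I twice, never c + 1, and every other value of [n] once. Each value v
-- is fixed by the lowering, which moves no entry across v, so exactly v − 1 entries lie below
-- v (Fubini). In the parking process the first car preferring v parks at v and the second at
-- v + 1, a spot no car prefers.
module Submission where

open import Defs
open import Data.Nat using (ℕ; zero; suc; _+_; _∸_; _≤_; _<_; _≡ᵇ_; _<ᵇ_; z≤n; s≤s)
open import Data.Nat.Properties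
open import Algebra.Properties.CommutativeMonoid.Sum +-0-commutativeMonoid
  using (sum; sum-permute; sum-replicate-zero)
open import Data.Bool using (Bool; true; false; T; if_then_else_)
open import Data.Bool.Properties using (T-≡; ¬-not; ∨-zeroʳ)
open import Data.Empty using (⊥)
open import Data.Fin using (Fin; toℕ) renaming (zero to fzero; suc to fsuc)
open import Data.Fin.Permutation using (Permutation′; _⟨$⟩ʳ_)
open import Data.Fin.Properties using (toℕ<n)
open import Data.List as List using (List; []; _∷_)
open import Data.List.Membership.Propositional using (_∈_; _∉_)
open import Data.List.Membership.DecPropositional _≟_ using (_∈?_)
open import Data.List.Relation.Unary.All as All using (All; []; _∷_)
open import Data.List.Relation.Unary.All.Properties using (map⁺)
open import Data.List.Relation.Unary.AllPairs using (AllPairs; []; _∷_)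
open import Data.List.Relation.Unary.Any using (here; there)
open import Data.List.Relation.Unary.Linked.Properties using (Linked⇒AllPairs)
open import Data.Maybe using (just)
open import Data.Product using (_×_; _,_; proj₁; ∃)
open import Data.Sum using (_⊎_; inj₁; inj₂; map₂)
open import Data.Vec as Vec using (Vec; tabulate; toList; lookup)
open import Data.Vec.Properties using (toList-map; lookup-map; lookup∘tabulate; map-id; map-∘)
open import Data.Vec.Relation.Unary.All.Properties using (toList⁺; tabulate⁺)
open import Function using (_∘_; Equivalence)
open import Relation.Nullary using (¬_; yes; no; contradiction)
open import Relation.Binary.PropositionalEquality

𝟙 : Bool → ℕ
𝟙 true  = 1
𝟙 false = 0

𝟙-≤1 : ∀ b → 𝟙 b ≤ 1
𝟙-≤1 true  = s≤s z≤n
𝟙-≤1 false = z≤n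

𝟙-pos : ∀ {b} → 1 ≤ 𝟙 b → T b
𝟙-pos {true} _ = _

≡ᵇ-true⇒≡ : ∀ {m n} → (m ≡ᵇ n) ≡ true → m ≡ n
≡ᵇ-true⇒≡ {m} {n} e = ≡ᵇ⇒≡ m n (Equivalence.from T-≡ e)

≡⇒≡ᵇ-true : ∀ {m n} → m ≡ n → (m ≡ᵇ n) ≡ true
≡⇒≡ᵇ-true {m} {n} e = Equivalence.to T-≡ (≡⇒≡ᵇ m n e)

≢⇒≡ᵇ-false : ∀ {m n} → m ≢ n → (m ≡ᵇ n) ≡ false
≢⇒≡ᵇ-false m≢n = ¬-not (m≢n ∘ ≡ᵇ-true⇒≡)

<ᵇ-suc : ∀ y v → v ≢ suc y → (y <ᵇ v) ≡ (suc y <ᵇ v)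
<ᵇ-suc y       zero          _  = refl
<ᵇ-suc zero    (suc zero)    v≢1 = contradiction refl v≢1
<ᵇ-suc zero    (suc (suc v)) _  = refl
<ᵇ-suc (suc y) (suc v)       v≢ = <ᵇ-suc y v (v≢ ∘ cong suc)

countL-∷-≡ : ∀ {c x} L → c ≡ x → countL c (x ∷ L) ≡ suc (countL c L)
countL-∷-≡ L c≡x rewrite ≡⇒≡ᵇ-true c≡x = refl

countL-∷-self : ∀ x L → countL x (x ∷ L) ≡ suc (countL x L)
countL-∷-self x L = countL-∷-≡ L refl

countL-∷-≢ : ∀ {c x} L → c ≢ x → countL c (x ∷ L) ≡ countL c L
countL-∷-≢ L c≢x rewrite ≢⇒≡ᵇ-false c≢x = refl

countL-≤-∷ : ∀ c x L → countL c L ≤ countL c (x ∷ L)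
countL-≤-∷ c x L with c ≟ x
... | yes c≡x rewrite countL-∷-≡ L c≡x = n≤1+n _
... | no  c≢x rewrite countL-∷-≢ L c≢x = ≤-refl

countL-∷-pos : ∀ {c x} L → 1 ≤ countL c (x ∷ L) → c ≡ x ⊎ 1 ≤ countL c L
countL-∷-pos {c} {x} L pos with c ≟ x
... | yes c≡x = inj₁ c≡x
... | no  c≢x = inj₂ (subst (1 ≤_) (countL-∷-≢ L c≢x) pos)

countL-∷-+ : ∀ c x Q T → countL c (x ∷ Q) + countL c T ≡ countL c Q + countL c (x ∷ T)
countL-∷-+ c x Q T with c ≟ x
... | yes c≡x rewrite countL-∷-≡ Q c≡x | countL-∷-≡ T c≡x = sym (+-suc _ _)
... | no  c≢x rewrite countL-∷-≢ Q c≢x | countL-∷-≢ T c≢x = refl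

countL-map-≤ : ∀ (f : ℕ → ℕ) {a c} → (∀ x → f x ≡ c → x ≡ a) →
               ∀ L → countL c (List.map f L) ≤ countL a L
countL-map-≤ f fiber [] = z≤n
countL-map-≤ f {a} {c} fiber (x ∷ L) with c ≟ f x
... | no c≢fx rewrite countL-∷-≢ (List.map f L) c≢fx =
  ≤-trans (countL-map-≤ f fiber L) (countL-≤-∷ a x L)
... | yes c≡fx rewrite countL-∷-≡ (List.map f L) c≡fx | countL-∷-≡ L (sym (fiber x (sym c≡fx))) =
  s≤s (countL-map-≤ f fiber L)

countL-map-≤₂ : ∀ (f : ℕ → ℕ) {a b c} → (∀ x → f x ≡ c → x ≡ a ⊎ x ≡ b) →
                ∀ L → countL c (List.map f L) ≤ countL a L + countL b L
countL-map-≤₂ f fiber [] = z≤n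
countL-map-≤₂ f {a} {b} {c} fiber (x ∷ L) with c ≟ f x
... | no c≢fx rewrite countL-∷-≢ (List.map f L) c≢fx =
  ≤-trans (countL-map-≤₂ f fiber L) (+-mono-≤ (countL-≤-∷ a x L) (countL-≤-∷ b x L))
... | yes c≡fx rewrite countL-∷-≡ (List.map f L) c≡fx with fiber x (sym c≡fx)
...   | inj₁ refl rewrite countL-∷-self x L =
  s≤s (≤-trans (countL-map-≤₂ f fiber L) (+-monoʳ-≤ (countL x L) (countL-≤-∷ b x L)))
...   | inj₂ refl rewrite countL-∷-self x L | +-suc (countL a (x ∷ L)) (countL x L) =
  s≤s (≤-trans (countL-map-≤₂ f fiber L) (+-monoˡ-≤ (countL x L) (countL-≤-∷ a x L)))

countL-map-pos : ∀ (f : ℕ → ℕ) {c} L → 1 ≤ countL c (List.map f L) →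
                 ∃ λ x → f x ≡ c × 1 ≤ countL x L
countL-map-pos f {c} (x ∷ L) pos with c ≟ f x
... | yes c≡fx = x , sym c≡fx , subst (1 ≤_) (sym (countL-∷-self x L)) (s≤s z≤n)
... | no  c≢fx with countL-map-pos f L (subst (1 ≤_) (countL-∷-≢ (List.map f L) c≢fx) pos)
...   | y , fy≡c , pos′ = y , fy≡c , ≤-trans pos′ (countL-≤-∷ y x L)

countLess-map : ∀ (f : ℕ → ℕ) {v} → (∀ x → (f x <ᵇ v) ≡ (x <ᵇ v)) →
                ∀ L → countLess v (List.map f L) ≡ countLess v L
countLess-map f same [] = refl
countLess-map f {v} same (x ∷ L) rewrite same x =
  cong (λ k → if x <ᵇ v then suc k else k) (countLess-map f same L)

memb⇒∈ : ∀ {x} xs → memb x xs ≡ true → x ∈ xs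
memb⇒∈ {x} (y ∷ ys) e with x ≟ y
... | yes x≡y = here x≡y
... | no  x≢y rewrite ≢⇒≡ᵇ-false x≢y = there (memb⇒∈ ys e)

∈⇒memb : ∀ {x xs} → x ∈ xs → memb x xs ≡ true
∈⇒memb (here x≡y) rewrite ≡⇒≡ᵇ-true x≡y = refl
∈⇒memb {x} {y ∷ _} (there x∈ys) rewrite ∈⇒memb x∈ys = ∨-zeroʳ (x ≡ᵇ y)

∉⇒memb : ∀ {x xs} → x ∉ xs → memb x xs ≡ false
∉⇒memb {xs = xs} x∉xs = ¬-not (x∉xs ∘ memb⇒∈ xs)

findSpot-free : ∀ {n a} occ → a ≤ n → memb a occ ≡ false → findSpot n occ a ≡ just a
findSpot-free occ a≤n a-free rewrite +-∸-assoc 1 a≤n | a-free = refl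

m∸n≡1+[m∸1+n] : ∀ {m n} → suc n ≤ m → m ∸ n ≡ suc (m ∸ suc n)
m∸n≡1+[m∸1+n] = +-∸-assoc 1

findSpot-next : ∀ {n a} occ → suc a ≤ n → memb a occ ≡ true → memb (suc a) occ ≡ false →
                findSpot n occ a ≡ just (suc a)
findSpot-next {n} {a} occ sa≤n a-taken sa-free
  rewrite +-∸-assoc 1 (≤-trans (n≤1+n a) sa≤n) | a-taken | m∸n≡1+[m∸1+n] sa≤n | sa-free = refl

park-∷ : ∀ {n} occ a {as s ss} → findSpot n occ a ≡ just s → park n (s ∷ occ) as ≡ just ss →
         park n occ (a ∷ as) ≡ just (s ∷ ss)
park-∷ {n} occ a {as} found parked with findSpot n occ a
park-∷ {n} occ a {as} {s} refl parked | just .s with park n (s ∷ occ) as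
park-∷ occ a refl refl | just _ | just _ = refl

-- Spots occupied once the cars with preferences Q have parked with displacement at most one:
-- the first car preferring s takes s, the second takes s + 1.
data Taken (Q : List ℕ) : ℕ → Set where
  first  : ∀ {s} → 1 ≤ countL s Q → Taken Q s
  second : ∀ {c} → 2 ≤ countL c Q → Taken Q (suc c)

record Occupancy (Q occ : List ℕ) : Set where
  field
    sound    : ∀ {s} → s ∈ occ → Taken Q s
    complete : ∀ {s} → 1 ≤ countL s Q → s ∈ occ

taken-∷ : ∀ {Q s} t → Taken Q s → Taken (t ∷ Q) s
taken-∷ {Q} {s} t (first pos)  = first (≤-trans pos (countL-≤-∷ s t Q))
taken-∷ {Q} t (second {c} two) = second (≤-trans two (countL-≤-∷ c t Q))

occupancy-first : ∀ {Q occ} t → Occupancy Q occ → Occupancy (t ∷ Q) (t ∷ occ)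
occupancy-first {Q} {occ} t O = record { sound = sound′ ; complete = complete′ }
  where
  open Occupancy O
  sound′ : ∀ {s} → s ∈ t ∷ occ → Taken (t ∷ Q) s
  sound′ (here refl) = first (subst (1 ≤_) (sym (countL-∷-self t Q)) (s≤s z≤n))
  sound′ (there s∈)  = taken-∷ t (sound s∈)
  complete′ : ∀ {s} → 1 ≤ countL s (t ∷ Q) → s ∈ t ∷ occ
  complete′ pos with countL-∷-pos Q pos
  ... | inj₁ s≡t = here s≡t
  ... | inj₂ pos′ = there (complete pos′)

occupancy-second : ∀ {Q occ t} → countL t Q ≡ 1 → Occupancy Q occ →
                     Occupancy (t ∷ Q) (suc t ∷ occ)
occupancy-second {Q} {occ} {t} once O = record { sound = sound′ ; complete = complete′ }
  where
  open Occupancy O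
  sound′ : ∀ {s} → s ∈ suc t ∷ occ → Taken (t ∷ Q) s
  sound′ (here refl) = second (subst (2 ≤_) (sym (trans (countL-∷-self t Q) (cong suc once))) ≤-refl)
  sound′ (there s∈)  = taken-∷ t (sound s∈)
  complete′ : ∀ {s} → 1 ≤ countL s (t ∷ Q) → s ∈ suc t ∷ occ
  complete′ pos with countL-∷-pos Q pos
  ... | inj₁ refl = there (complete (≤-reflexive (sym once)))
  ... | inj₂ pos′ = there (complete pos′)

record UnitMultiplicities (n : ℕ) (μ : ℕ → ℕ) : Set where
  field
    atMostTwice   : ∀ c → μ c ≤ 2
    bounded       : ∀ c → 1 ≤ μ c → c ≤ n
    twice⇒bounded : ∀ c → 2 ≤ μ c → suc c ≤ n
    twice⇒absent  : ∀ c → 2 ≤ μ c → μ (suc c) ≡ 0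

module _ {n : ℕ} {μ : ℕ → ℕ} (U : UnitMultiplicities n μ) where
  open UnitMultiplicities U

  findSpot-first : ∀ {Q occ t} → (∀ c → countL c Q ≤ μ c) → Occupancy Q occ →
                   countL t Q ≡ 0 → 1 ≤ μ t → findSpot n occ t ≡ just t
  findSpot-first {Q} {occ} {t} queued O none arriving =
    findSpot-free occ (bounded t arriving) (∉⇒memb (free ∘ Occupancy.sound O))
    where
    free : ¬ Taken Q t
    free (first pos)      = contradiction (subst (1 ≤_) none pos) λ ()
    free (second {c} two) = contradiction (twice⇒absent c (≤-trans two (queued c))) λ μt≡0 →
                            contradiction (subst (1 ≤_) μt≡0 arriving) λ ()

  findSpot-second : ∀ {Q occ t} → (∀ c → countL c Q ≤ μ c) → Occupancy Q occ →
                    countL t Q ≡ 1 → 2 ≤ μ t → findSpot n occ t ≡ just (suc t)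
  findSpot-second {Q} {occ} {t} queued O once arriving =
    findSpot-next occ (twice⇒bounded t arriving)
      (∈⇒memb (Occupancy.complete O (≤-reflexive (sym once))))
      (∉⇒memb (free ∘ Occupancy.sound O))
    where
    free : ¬ Taken Q (suc t)
    free (first pos)  =
      contradiction (subst (1 ≤_) (twice⇒absent t arriving) (≤-trans pos (queued (suc t)))) λ ()
    free (second two) = contradiction (subst (2 ≤_) once two) λ { (s≤s ()) }

  parks-unit : ∀ T Q occ → (∀ c → countL c Q + countL c T ≡ μ c) → Occupancy Q occ →
               ∃ λ ss → park n occ T ≡ just ss × UnitSpots T ss
  parks-unit [] Q occ split O = [] , refl , []
  parks-unit (t ∷ T) Q occ split O = arrive (countL t Q) refl
    where
    split′ : ∀ c → countL c (t ∷ Q) + countL c T ≡ μ c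
    split′ c = trans (countL-∷-+ c t Q T) (split c)

    queued : ∀ c → countL c Q ≤ μ c
    queued c = subst (countL c Q ≤_) (split c) (m≤m+n _ _)

    arrivals : countL t Q < μ t
    arrivals = subst (countL t Q <_) (trans (cong (countL t Q +_) (sym (countL-∷-self t T))) (split t))
                     (m<m+n (countL t Q) (s≤s z≤n))

    arrive : ∀ k → countL t Q ≡ k → ∃ λ ss → park n occ (t ∷ T) ≡ just ss × UnitSpots (t ∷ T) ss
    arrive 0 none with parks-unit T (t ∷ Q) (t ∷ occ) split′ (occupancy-first t O)
    ... | ss , parked , unit =
      t ∷ ss , park-∷ occ t (findSpot-first queued O none (subst (_< μ t) none arrivals)) parked ,
      inj₁ refl ∷ unit
    arrive 1 once with parks-unit T (t ∷ Q) (suc t ∷ occ) split′ (occupancy-second once O)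
    ... | ss , parked , unit =
      suc t ∷ ss , park-∷ occ t (findSpot-second queued O once (subst (_< μ t) once arrivals)) parked ,
      inj₂ refl ∷ unit
    arrive (suc (suc k)) many =
      contradiction (≤-trans (subst (_< μ t) many arrivals) (atMostTwice t)) λ { (s≤s (s≤s ())) }

unit-parking : ∀ {n} L → UnitMultiplicities n (λ c → countL c L) →
               ∃ λ ss → park n [] L ≡ just ss × UnitSpots L ss
unit-parking L U = parks-unit U L [] [] (λ _ → refl) record { sound = λ () ; complete = λ () }

countL-tabulate : ∀ {m} (h : Fin m → ℕ) c → countL c (toList (tabulate h)) ≡ sum (λ i → 𝟙 (c ≡ᵇ h i))
countL-tabulate {zero}  h c = refl
countL-tabulate {suc m} h c with c ≡ᵇ h fzero
... | true  = cong suc (countL-tabulate (h ∘ fsuc) c)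
... | false = countL-tabulate (h ∘ fsuc) c

countLess-tabulate : ∀ {m} (h : Fin m → ℕ) c → countLess c (toList (tabulate h)) ≡ sum (λ i → 𝟙 (h i <ᵇ c))
countLess-tabulate {zero}  h c = refl
countLess-tabulate {suc m} h c with h fzero <ᵇ c
... | true  = cong suc (countLess-tabulate (h ∘ fsuc) c)
... | false = countLess-tabulate (h ∘ fsuc) c

sum-≡ᵇ-toℕ : ∀ m x → sum {m} (λ j → 𝟙 (x ≡ᵇ toℕ j)) ≡ 𝟙 (x <ᵇ m)
sum-≡ᵇ-toℕ zero    x       = refl
sum-≡ᵇ-toℕ (suc m) zero    = cong suc (sum-replicate-zero m)
sum-≡ᵇ-toℕ (suc m) (suc x) = sum-≡ᵇ-toℕ m x

sum-<ᵇ-toℕ : ∀ m y → y ≤ m → sum {m} (λ j → 𝟙 (toℕ j <ᵇ y)) ≡ y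
sum-<ᵇ-toℕ m       zero    _         = sum-replicate-zero m
sum-<ᵇ-toℕ (suc m) (suc y) (s≤s y≤m) = cong suc (sum-<ᵇ-toℕ m y y≤m)

module _ {n : ℕ} (π : Permutation′ n) where

  entry : Fin n → ℕ
  entry i = suc (toℕ (π ⟨$⟩ʳ i))

  sum-oneLine : (F : ℕ → ℕ) → sum {n} (λ i → F (entry i)) ≡ sum {n} (λ j → F (suc (toℕ j)))
  sum-oneLine F = sym (sum-permute (λ j → F (suc (toℕ j))) π)

  countL-oneLine-zero : countL 0 (toList (oneLine π)) ≡ 0
  countL-oneLine-zero = trans (countL-tabulate entry 0) (sum-replicate-zero n)

  countL-oneLine-suc : ∀ x → countL (suc x) (toList (oneLine π)) ≡ 𝟙 (x <ᵇ n)
  countL-oneLine-suc x = begin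
    countL (suc x) (toList (oneLine π))      ≡⟨ countL-tabulate entry (suc x) ⟩
    sum {n} (λ i → 𝟙 (suc x ≡ᵇ entry i))     ≡⟨ sum-oneLine (λ v → 𝟙 (suc x ≡ᵇ v)) ⟩
    sum {n} (λ j → 𝟙 (x ≡ᵇ toℕ j))           ≡⟨ sum-≡ᵇ-toℕ n x ⟩
    𝟙 (x <ᵇ n)                               ∎
    where open ≡-Reasoning

  countL-oneLine-≤1 : ∀ c → countL c (toList (oneLine π)) ≤ 1
  countL-oneLine-≤1 zero    rewrite countL-oneLine-zero  = z≤n
  countL-oneLine-≤1 (suc x) rewrite countL-oneLine-suc x = 𝟙-≤1 (x <ᵇ n)

  countL-oneLine-bounded : ∀ c → 1 ≤ countL c (toList (oneLine π)) → c ≤ n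
  countL-oneLine-bounded zero    pos rewrite countL-oneLine-zero  = contradiction pos λ ()
  countL-oneLine-bounded (suc x) pos rewrite countL-oneLine-suc x = <ᵇ⇒< x n (𝟙-pos pos)

  countLess-oneLine : ∀ y → y ≤ n → countLess (suc y) (toList (oneLine π)) ≡ y
  countLess-oneLine y y≤n = begin
    countLess (suc y) (toList (oneLine π))   ≡⟨ countLess-tabulate entry (suc y) ⟩
    sum {n} (λ i → 𝟙 (entry i <ᵇ suc y))     ≡⟨ sum-oneLine (λ v → 𝟙 (v <ᵇ suc y)) ⟩
    sum {n} (λ j → 𝟙 (toℕ j <ᵇ y))           ≡⟨ sum-<ᵇ-toℕ n y y≤n ⟩
    y                                        ∎
    where open ≡-Reasoning

  inRange-oneLine : InRange (oneLine π)
  inRange-oneLine = toList⁺ (tabulate⁺ λ i → s≤s z≤n , toℕ<n (π ⟨$⟩ʳ i))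

lower : ℕ → ℕ → ℕ
lower i a = if a ≡ᵇ suc i then i else a

lower* : List ℕ → ℕ → ℕ
lower* I a = List.foldr lower a I

lower-suc : ∀ i → lower i (suc i) ≡ i
lower-suc i rewrite ≡⇒≡ᵇ-true {i} refl = refl

lower-≢ : ∀ {i a} → a ≢ suc i → lower i a ≡ a
lower-≢ a≢ rewrite ≢⇒≡ᵇ-false a≢ = refl

infix 4 _≪_
_≪_ : ℕ → ℕ → Set
a ≪ b = 2 + a ≤ b

≪-trans : ∀ {a b c} → a ≪ b → b ≪ c → a ≪ c
≪-trans {b = b} a≪b b≪c = ≤-trans a≪b (≤-trans (m≤n+m b 2) b≪c)

≪⇒≢suc : ∀ {a b} → a ≪ b → b ≢ suc a
≪⇒≢suc a≪b refl = 1+n≰n a≪b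

Nonconsecutive : List ℕ → Set
Nonconsecutive = AllPairs _≪_

nonconsecutive-suc-∉ : ∀ {I c} → Nonconsecutive I → c ∈ I → suc c ∈ I → ⊥
nonconsecutive-suc-∉ (_ ∷ _)      (here refl) (here sc≡c)   = 1+n≢n sc≡c
nonconsecutive-suc-∉ (c≪J ∷ _)    (here refl) (there sc∈J)  = 1+n≰n (All.lookup c≪J sc∈J)
nonconsecutive-suc-∉ (sc≪J ∷ _)   (there c∈J) (here refl)   = 1+n≰n (≤-trans (m≤n+m _ 2) (All.lookup sc≪J c∈J))
nonconsecutive-suc-∉ (_ ∷ J-nc)   (there c∈J) (there sc∈J)  = nonconsecutive-suc-∉ J-nc c∈J sc∈J

lower*-cases : ∀ {I} → Nonconsecutive I → ∀ a →
               lower* I a ≡ a ⊎ (suc (lower* I a) ≡ a × lower* I a ∈ I)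
lower*-cases [] a = inj₁ refl
lower*-cases {i ∷ J} (i≪J ∷ J-nc) a with lower*-cases J-nc a
... | inj₂ (lowered , j∈J) rewrite lower-≢ (≪⇒≢suc (All.lookup i≪J j∈J)) =
  inj₂ (lowered , there j∈J)
... | inj₁ fixed rewrite fixed with a ≟ suc i
...   | yes refl rewrite lower-suc i = inj₂ (refl , here refl)
...   | no  a≢  rewrite lower-≢ a≢   = inj₁ refl

lower*-suc : ∀ {I c} → Nonconsecutive I → c ∈ I → lower* I (suc c) ≡ c
lower*-suc {i ∷ J} (i≪J ∷ J-nc) (here refl) with lower*-cases J-nc (suc i)
... | inj₁ fixed rewrite fixed = lower-suc i
... | inj₂ (lowered , j∈J) rewrite suc-injective lowered =
  contradiction (≤-trans (n≤1+n _) (All.lookup i≪J j∈J)) 1+n≰n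
lower*-suc {i ∷ J} (i≪J ∷ J-nc) (there c∈J) rewrite lower*-suc J-nc c∈J =
  lower-≢ (≪⇒≢suc (All.lookup i≪J c∈J))

module _ {I : List ℕ} (nc : Nonconsecutive I) where

  lower*-≤ : ∀ a → lower* I a ≤ a
  lower*-≤ a with lower*-cases nc a
  ... | inj₁ fixed        = ≤-reflexive fixed
  ... | inj₂ (lowered , _) = subst (lower* I a ≤_) lowered (n≤1+n _)

  lower*-preserves : ∀ {P : ℕ → Set} → All P I → ∀ {a} → P a → P (lower* I a)
  lower*-preserves {P} PI {a} Pa with lower*-cases nc a
  ... | inj₁ fixed      = subst P (sym fixed) Pa
  ... | inj₂ (_ , low∈I) = All.lookup PI low∈I

  lower*-fiber : ∀ {x c} → lower* I x ≡ c → x ≡ c ⊎ (x ≡ suc c × c ∈ I)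
  lower*-fiber {x} refl with lower*-cases nc x
  ... | inj₁ fixed            = inj₁ (sym fixed)
  ... | inj₂ (lowered , low∈I) = inj₂ (sym lowered , low∈I)

  lower*-∈ : ∀ {c} → c ∈ I → lower* I c ≡ c
  lower*-∈ {c} c∈I with lower*-cases nc c
  ... | inj₁ fixed             = fixed
  ... | inj₂ (lowered , low∈I) =
    contradiction (subst (_∈ I) (sym lowered) c∈I) (nonconsecutive-suc-∉ nc low∈I)

  lower*-idem : ∀ a → lower* I (lower* I a) ≡ lower* I a
  lower*-idem a with lower*-cases nc a
  ... | inj₁ fixed        = cong (lower* I) fixed
  ... | inj₂ (_ , low∈I)  = lower*-∈ low∈I

  lower*-<ᵇ : ∀ {v} → lower* I v ≡ v → ∀ x → (lower* I x <ᵇ v) ≡ (x <ᵇ v)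
  lower*-<ᵇ {v} fixed-v x with lower*-cases nc x
  ... | inj₁ fixed           = cong (_<ᵇ v) fixed
  ... | inj₂ (lowered , _)   = trans (<ᵇ-suc _ v v≢) (cong (_<ᵇ v) lowered)
    where
    v≢ : v ≢ suc (lower* I x)
    v≢ v≡ = 1+n≢n (sym (trans (cong (lower* I) (sym (trans v≡ lowered))) (trans fixed-v v≡)))

module _ {I : List ℕ} (nc : Nonconsecutive I) (L : List ℕ) where

  countL-map-lower*-≤ : ∀ c → countL c (List.map (lower* I) L) ≤ countL c L + countL (suc c) L
  countL-map-lower*-≤ c = countL-map-≤₂ (lower* I) (λ x e → map₂ proj₁ (lower*-fiber nc e)) L

  countL-map-lower*-∉ : ∀ {c} → c ∉ I → countL c (List.map (lower* I) L) ≤ countL c L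
  countL-map-lower*-∉ {c} c∉I = countL-map-≤ (lower* I) fiber L
    where
    fiber : ∀ x → lower* I x ≡ c → x ≡ c
    fiber x e with lower*-fiber nc e
    ... | inj₁ x≡c       = x≡c
    ... | inj₂ (_ , c∈I) = contradiction c∈I c∉I

  countL-map-lower*-∈ : ∀ {c} → c ∈ I → countL (suc c) (List.map (lower* I) L) ≡ 0
  countL-map-lower*-∈ {c} c∈I = n<1⇒n≡0 (≰⇒> absent)
    where
    absent : ¬ 1 ≤ countL (suc c) (List.map (lower* I) L)
    absent pos with countL-map-pos (lower* I) L pos
    ... | x , e , _ with lower*-fiber nc e
    ...   | inj₁ refl       = 1+n≢n (sym (trans (sym (lower*-suc nc c∈I)) e))
    ...   | inj₂ (_ , sc∈I) = nonconsecutive-suc-∉ nc c∈I sc∈I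

lower*-unitMultiplicities : ∀ {n I} → Nonconsecutive I → ∀ L →
  (∀ c → countL c L ≤ 1) → (∀ c → 1 ≤ countL c L → c ≤ n) →
  UnitMultiplicities n (λ c → countL c (List.map (lower* I) L))
lower*-unitMultiplicities {n} {I} nc L once bounded = record
  { atMostTwice   = λ c → ≤-trans (countL-map-lower*-≤ nc L c) (+-mono-≤ (once c) (once (suc c)))
  ; bounded       = bounded′
  ; twice⇒bounded = twice⇒bounded
  ; twice⇒absent  = λ c two → countL-map-lower*-∈ nc L (twice⇒∈ c two)
  }
  where
  bounded′ : ∀ c → 1 ≤ countL c (List.map (lower* I) L) → c ≤ n
  bounded′ c pos with countL-map-pos (lower* I) L pos
  ... | x , refl , pos′ = ≤-trans (lower*-≤ nc x) (bounded x pos′)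

  twice⇒bounded : ∀ c → 2 ≤ countL c (List.map (lower* I) L) → suc c ≤ n
  twice⇒bounded c two = bounded (suc c)
    (+-cancelˡ-≤ 1 _ _ (≤-trans two (≤-trans (countL-map-lower*-≤ nc L c) (+-monoˡ-≤ _ (once c)))))

  twice⇒∈ : ∀ c → 2 ≤ countL c (List.map (lower* I) L) → c ∈ I
  twice⇒∈ c two with c ∈? I
  ... | yes c∈I = c∈I
  ... | no  c∉I =
    contradiction (≤-trans two (≤-trans (countL-map-lower*-∉ nc L c∉I) (once c))) λ { (s≤s ()) }

≤1⇒≡ᵇ2-false : ∀ {k} → k ≤ 1 → (k ≡ᵇ 2) ≡ false
≤1⇒≡ᵇ2-false {k} k≤1 = ≢⇒≡ᵇ-false {k} {2} λ { refl → 1+n≰n k≤1 }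

δ≡map-lower : ∀ {n} i (w : Vec ℕ n) → (∀ x → x ≤ suc i → count x w ≤ 1) → δ i w ≡ Vec.map (lower i) w
δ≡map-lower i w once
  rewrite ≤1⇒≡ᵇ2-false (once (i ∸ 1) (≤-trans (m∸n≤m i 1) (n≤1+n i)))
        | ≤1⇒≡ᵇ2-false (once i (n≤1+n i))
        | ≤1⇒≡ᵇ2-false (once (suc i) ≤-refl) = refl

δ*-lower* : ∀ {n I} → Nonconsecutive I → (α : Vec ℕ n) → (∀ c → count c α ≤ 1) →
            δ* I α ≡ Vec.map (lower* I) α
δ*-lower* [] α once = sym (map-id α)
δ*-lower* {I = i ∷ K} (i≪K ∷ K-nc) α once = begin
  δ i (δ* K α)                              ≡⟨ cong (δ i) (δ*-lower* K-nc α once) ⟩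
  δ i (Vec.map (lower* K) α)                ≡⟨ δ≡map-lower i _ unrepeated ⟩
  Vec.map (lower i) (Vec.map (lower* K) α)  ≡⟨ map-∘ (lower i) (lower* K) α ⟨
  Vec.map (lower* (i ∷ K)) α                ∎
  where
  open ≡-Reasoning
  unrepeated : ∀ x → x ≤ suc i → count x (Vec.map (lower* K) α) ≤ 1
  unrepeated x x≤si rewrite toList-map (lower* K) α =
    ≤-trans (countL-map-≤ (lower* K) fiber (toList α)) (once x)
    where
    fiber : ∀ y → lower* K y ≡ x → y ≡ x
    fiber y e with lower*-fiber K-nc e
    ... | inj₁ y≡x       = y≡x
    ... | inj₂ (_ , x∈K) = contradiction (≤-trans (All.lookup i≪K x∈K) x≤si) 1+n≰n

module _ {n : ℕ} {I : List ℕ} (nc : Nonconsecutive I) (positive : All (1 ≤_) I) (π : Permutation′ n) where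

  lower*-oneLine-inRange : InRange (Vec.map (lower* I) (oneLine π))
  lower*-oneLine-inRange = subst (All _) (sym (toList-map (lower* I) (oneLine π)))
    (map⁺ (All.map (λ (1≤a , a≤n) → lower*-preserves nc positive 1≤a , ≤-trans (lower*-≤ nc _) a≤n)
                   (inRange-oneLine π)))

  lower*-oneLine-rank : ∀ c → lower* I c ≡ c → 1 ≤ c → c ≤ n →
                        c ≡ suc (countLess c (List.map (lower* I) (toList (oneLine π))))
  lower*-oneLine-rank (suc y) fixed _ sy≤n = cong suc (sym (begin
    countLess (suc y) (List.map (lower* I) (toList (oneLine π)))
      ≡⟨ countLess-map (lower* I) (lower*-<ᵇ nc fixed) (toList (oneLine π)) ⟩
    countLess (suc y) (toList (oneLine π))
      ≡⟨ countLess-oneLine π y (≤-trans (n≤1+n y) sy≤n) ⟩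
    y ∎))
    where open ≡-Reasoning

  lower*-oneLine-fubini : IsFubiniRanking (Vec.map (lower* I) (oneLine π))
  lower*-oneLine-fubini = lower*-oneLine-inRange , fubini
    where
    fubini : ∀ i → lookup (Vec.map (lower* I) (oneLine π)) i
                 ≡ suc (countLess (lookup (Vec.map (lower* I) (oneLine π)) i)
                                  (toList (Vec.map (lower* I) (oneLine π))))
    fubini i rewrite lookup-map i (lower* I) (oneLine π) | lookup∘tabulate (entry π) i
                   | toList-map (lower* I) (oneLine π) =
      lower*-oneLine-rank (lower* I (entry π i)) (lower*-idem nc (entry π i))
        (lower*-preserves nc positive (s≤s z≤n)) (≤-trans (lower*-≤ nc _) (toℕ<n (π ⟨$⟩ʳ i)))

  lower*-oneLine-unitInterval : IsUnitIntervalPF (Vec.map (lower* I) (oneLine π))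
  lower*-oneLine-unitInterval = lower*-oneLine-inRange ,
    subst (λ L → ∃ λ ss → park n [] L ≡ just ss × UnitSpots L ss) (sym (toList-map (lower* I) (oneLine π)))
      (unit-parking _ (lower*-unitMultiplicities nc (toList (oneLine π))
                                                 (countL-oneLine-≤1 π) (countL-oneLine-bounded π)))

corollary3p14 : (n : ℕ) (I : List ℕ) (π : Permutation′ n) →
    NonconsecSubset n I → UFR (δ* I (oneLine π))
corollary3p14 n I π (bounds , linked) =
  subst UFR (sym (δ*-lower* nc (oneLine π) (countL-oneLine-≤1 π)))
    (lower*-oneLine-fubini nc positive π , lower*-oneLine-unitInterval nc positive π)
  where
  nc : Nonconsecutive I
  nc = Linked⇒AllPairs ≪-trans linked
  positive : All (1 ≤_) I
  positive = All.map proj₁ bounds
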